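{- For any odd $n\ge 3$ and any Greene–Kleitman chain $C$ of $Q_{n-2}$ with $|C|=1$, let $L:=\ell({*}C{*})$ and $F:=f({*}C{*})$ (chains of $Q_n$). Then the bottom end of $L$ is adjacent to the top end of $F$ in $Q_n$, and the chains ${*}L{*}$ and $f({*}F{*})$ are connected at their bottom ends in $Q_{n+2}$ (their bottom ends are adjacent). Specifically, if $C=u*v$ with $u,v\in D$, then $L={*}\,u\,0\,v\,1$, $F=0\,u\,1\,v\,{*}$, ${*}L{*}={*}\,{*}\,u\,0\,v\,1\,{*}$ and $f({*}F{*})=0\,0\,u\,1\,v\,1\,{*}$, so that both $L$ and $F$, as well as ${*}L{*}$ and $f({*}F{*})$, differ in exactly three positions.
   Context: $Q_n$: vertices are bitstrings of length $n$, adjacent if they differ in one bit. $D$ is the set of bitstrings (including the empty string) with equally many 0s and 1s such that every prefix has at least as many 0s as 1s. A Greene–Kleitman chain of $Q_n$ is a string $C=u_0*u_1*\cdots*u_h$ of length $n$ over $\{0,1,*\}$ with $u_j\in D$; $|C|=h$ is the number of $*$s; its bottom end (resp. top end) is obtained by replacing all $*$s by $0$ (resp. $1$). For a string $S$ over $\{0,1,*\}$ with at least two $*$s, $f(S)$ (resp. $\ell(S)$) is obtained by replacing the first two (resp. last two) $*$s by $0$ and $1$, respectively. ${*}S{*}$ denotes $S$ with a $*$ prepended and appended. -}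

module Defs where

open import Data.Bool using (Bool; true; false)
open import Data.Nat using (ℕ; zero; suc; _≤_; _+_)
open import Data.List using (List; []; _∷_; _++_; length; map; reverse; [_])
open import Data.Product using (_×_)
open import Relation.Binary.PropositionalEquality using (_≡_)

-- Bits: false = 0, true = 1.  Vertices of Q_n are bitstrings (List Bool) of length n.
Bits : Set
Bits = List Bool

zeros : Bits → ℕ
zeros [] = 0
zeros (false ∷ w) = suc (zeros w)
zeros (true ∷ w) = zeros w

ones : Bits → ℕ
ones [] = 0
ones (false ∷ w) = ones w
ones (true ∷ w) = suc (ones w)

D : Bits → Set
D w = (zeros w ≡ ones w) × (∀ p q → p ++ q ≡ w → ones p ≤ zeros p)

data Sym : Set where
  𝟘 𝟙 ⋆ : Sym

bitSym : Bool → Sym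
bitSym false = 𝟘
bitSym true = 𝟙

emb : Bits → List Sym
emb = map bitSym

data GKChain : List Sym → Set where
  gk-single : ∀ {u} → D u → GKChain (emb u)
  gk-cons   : ∀ {u S} → D u → GKChain S → GKChain (emb u ++ ⋆ ∷ S)

GKChainOf : ℕ → List Sym → Set
GKChainOf n C = GKChain C × length C ≡ n

-- |C| : number of *s.
stars : List Sym → ℕ
stars [] = 0
stars (⋆ ∷ S) = suc (stars S)
stars (𝟘 ∷ S) = stars S
stars (𝟙 ∷ S) = stars S

bottomSym : Sym → Bool
bottomSym 𝟘 = false
bottomSym 𝟙 = true
bottomSym ⋆ = false

topSym : Sym → Bool
topSym 𝟘 = false
topSym 𝟙 = true
topSym ⋆ = true

bottom : List Sym → Bits
bottom = map bottomSym

top : List Sym → Bits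
top = map topSym

replaceFirst : Sym → List Sym → List Sym
replaceFirst a [] = []
replaceFirst a (⋆ ∷ S) = a ∷ S
replaceFirst a (𝟘 ∷ S) = 𝟘 ∷ replaceFirst a S
replaceFirst a (𝟙 ∷ S) = 𝟙 ∷ replaceFirst a S

f : List Sym → List Sym
f [] = []
f (⋆ ∷ S) = 𝟘 ∷ replaceFirst 𝟙 S
f (𝟘 ∷ S) = 𝟘 ∷ f S
f (𝟙 ∷ S) = 𝟙 ∷ f S

-- ℓ(S): replace the last two *s by 0 and 1 respectively
-- (i.e. in the reversed string, the first * becomes 1 and the second becomes 0).
ℓaux : List Sym → List Sym
ℓaux [] = []
ℓaux (⋆ ∷ S) = 𝟙 ∷ replaceFirst 𝟘 S
ℓaux (𝟘 ∷ S) = 𝟘 ∷ ℓaux S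
ℓaux (𝟙 ∷ S) = 𝟙 ∷ ℓaux S

ℓ : List Sym → List Sym
ℓ S = reverse (ℓaux (reverse S))

starred : List Sym → List Sym
starred S = ⋆ ∷ (S ++ [ ⋆ ])

hamming : List Sym → List Sym → ℕ
hamming [] [] = 0
hamming (x ∷ xs) (y ∷ ys) = ext x y + hamming xs ys
  where
  ext : Sym → Sym → ℕ
  ext 𝟘 𝟘 = 0
  ext 𝟙 𝟙 = 0
  ext ⋆ ⋆ = 0
  ext _ _ = 1
hamming _ _ = 0

bitDiff : Bits → Bits → ℕ
bitDiff [] [] = 0
bitDiff (false ∷ xs) (false ∷ ys) = bitDiff xs ys
bitDiff (true ∷ xs) (true ∷ ys) = bitDiff xs ys
bitDiff (_ ∷ xs) (_ ∷ ys) = suc (bitDiff xs ys)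
bitDiff _ _ = 0

Adjacent : ℕ → Bits → Bits → Set
Adjacent n x y = (length x ≡ n) × (length y ≡ n) × (bitDiff x y ≡ 1)

-- A Greene–Kleitman chain with one star is u * v with u, v star-free, so f and ℓ only
-- replace stars at known positions and every object in the statement has an explicit
-- normal form; the two adjacencies then come from a single flipped bit, since the
-- outer stars and the final symbols turn into equal bits in both ends.
module Submission where

open import Defs
open import Data.Bool using (Bool; true; false)
open import Data.Nat using (ℕ; suc; _≤_; _∸_; _+_; _%_)
open import Data.Nat.Properties using (+-comm; m+[n∸m]≡n; suc-injective; ≤-trans; n≤1+n)
open import Data.List using (List; []; _∷_; _++_; [_]; length; map; reverse)
open import Data.List.Properties
  using (++-assoc; length-++; length-map; length-reverse; reverse-++; unfold-reverse; reverse-map; reverse-involutive)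
open import Data.Product using (_×_; _,_; ∃₂)
open import Function using (_∘_; id)
open import Relation.Binary.PropositionalEquality
  using (_≡_; refl; sym; trans; cong; cong₂; _≗_; module ≡-Reasoning)

private
  variable
    A : Set

reverse-frame : ∀ (a b c : A) xs ys →
  reverse (a ∷ xs ++ b ∷ ys ++ [ c ]) ≡ c ∷ reverse ys ++ b ∷ reverse xs ++ [ a ]
reverse-frame a b c xs ys = begin
  reverse (a ∷ xs ++ b ∷ ys ++ [ c ])            ≡⟨ unfold-reverse a (xs ++ b ∷ ys ++ [ c ]) ⟩
  reverse (xs ++ b ∷ ys ++ [ c ]) ++ [ a ]       ≡⟨ cong (_++ [ a ]) (reverse-++ xs (b ∷ ys ++ [ c ])) ⟩
  (reverse (b ∷ ys ++ [ c ]) ++ reverse xs) ++ [ a ]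
    ≡⟨ cong (λ zs → (zs ++ reverse xs) ++ [ a ]) (unfold-reverse b (ys ++ [ c ])) ⟩
  ((reverse (ys ++ [ c ]) ++ [ b ]) ++ reverse xs) ++ [ a ]
    ≡⟨ cong (λ zs → ((zs ++ [ b ]) ++ reverse xs) ++ [ a ]) (reverse-++ ys [ c ]) ⟩
  ((c ∷ reverse ys ++ [ b ]) ++ reverse xs) ++ [ a ]
    ≡⟨ cong (c ∷_) (++-assoc (reverse ys ++ [ b ]) (reverse xs) [ a ]) ⟩
  c ∷ (reverse ys ++ [ b ]) ++ reverse xs ++ [ a ]
    ≡⟨ cong (c ∷_) (++-assoc (reverse ys) [ b ] (reverse xs ++ [ a ])) ⟩
  c ∷ reverse ys ++ b ∷ reverse xs ++ [ a ]      ∎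
  where open ≡-Reasoning

stars-++ : ∀ xs ys → stars (xs ++ ys) ≡ stars xs + stars ys
stars-++ []       ys = refl
stars-++ (𝟘 ∷ xs) ys = stars-++ xs ys
stars-++ (𝟙 ∷ xs) ys = stars-++ xs ys
stars-++ (⋆ ∷ xs) ys = cong suc (stars-++ xs ys)

stars-emb : ∀ u → stars (emb u) ≡ 0
stars-emb []          = refl
stars-emb (false ∷ u) = stars-emb u
stars-emb (true ∷ u)  = stars-emb u

stars-emb-++ : ∀ u S → stars (emb u ++ S) ≡ stars S
stars-emb-++ u S = trans (stars-++ (emb u) S) (cong (_+ stars S) (stars-emb u))

one-star-chain : ∀ {C} → GKChain C → stars C ≡ 1 → ∃₂ λ u v → C ≡ emb u ++ ⋆ ∷ emb v
one-star-chain (gk-single {u} _) one with () ← trans (sym (stars-emb u)) one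
one-star-chain (gk-cons {u} _ (gk-single {v} _)) _ = u , v , refl
one-star-chain (gk-cons {u} _ (gk-cons {w} {S} _ _)) one
  with () ← trans (sym (stars-emb-++ w (⋆ ∷ S))) (suc-injective (trans (sym (stars-emb-++ u _)) one))

length-starred : ∀ S → length (starred S) ≡ suc (suc (length S))
length-starred S = cong suc (trans (length-++ S) (+-comm (length S) 1))

length-replaceFirst : ∀ a S → length (replaceFirst a S) ≡ length S
length-replaceFirst a []      = refl
length-replaceFirst a (⋆ ∷ S) = refl
length-replaceFirst a (𝟘 ∷ S) = cong suc (length-replaceFirst a S)
length-replaceFirst a (𝟙 ∷ S) = cong suc (length-replaceFirst a S)

length-f : ∀ S → length (f S) ≡ length S
length-f []      = refl
length-f (⋆ ∷ S) = cong suc (length-replaceFirst 𝟙 S)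
length-f (𝟘 ∷ S) = cong suc (length-f S)
length-f (𝟙 ∷ S) = cong suc (length-f S)

length-ℓaux : ∀ S → length (ℓaux S) ≡ length S
length-ℓaux []      = refl
length-ℓaux (⋆ ∷ S) = cong suc (length-replaceFirst 𝟘 S)
length-ℓaux (𝟘 ∷ S) = cong suc (length-ℓaux S)
length-ℓaux (𝟙 ∷ S) = cong suc (length-ℓaux S)

length-ℓ : ∀ S → length (ℓ S) ≡ length S
length-ℓ S = begin
  length (reverse (ℓaux (reverse S))) ≡⟨ length-reverse (ℓaux (reverse S)) ⟩
  length (ℓaux (reverse S))           ≡⟨ length-ℓaux (reverse S) ⟩
  length (reverse S)                  ≡⟨ length-reverse S ⟩
  length S                            ∎
  where open ≡-Reasoning

replaceFirst-emb-++ : ∀ a u S → replaceFirst a (emb u ++ S) ≡ emb u ++ replaceFirst a S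
replaceFirst-emb-++ a []          S = refl
replaceFirst-emb-++ a (false ∷ u) S = cong (𝟘 ∷_) (replaceFirst-emb-++ a u S)
replaceFirst-emb-++ a (true ∷ u)  S = cong (𝟙 ∷_) (replaceFirst-emb-++ a u S)

reverse-emb : ∀ u → reverse (emb u) ≡ emb (reverse u)
reverse-emb u = sym (reverse-map bitSym u)

starred-++-∷ : ∀ xs y ys → starred (xs ++ y ∷ ys) ≡ ⋆ ∷ xs ++ y ∷ ys ++ [ ⋆ ]
starred-++-∷ xs y ys = cong (⋆ ∷_) (++-assoc xs (y ∷ ys) [ ⋆ ])

starred-frame : ∀ a xs b ys c → starred (a ∷ xs ++ b ∷ ys ++ [ c ]) ≡ ⋆ ∷ a ∷ xs ++ b ∷ ys ++ c ∷ [ ⋆ ]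
starred-frame a xs b ys c =
  trans (starred-++-∷ (a ∷ xs) b (ys ++ [ c ])) (cong (λ zs → ⋆ ∷ a ∷ xs ++ b ∷ zs) (++-assoc ys [ c ] [ ⋆ ]))

f-starred-emb-++ : ∀ u S → f (starred (emb u ++ ⋆ ∷ S)) ≡ 𝟘 ∷ emb u ++ 𝟙 ∷ S ++ [ ⋆ ]
f-starred-emb-++ u S = begin
  f (starred (emb u ++ ⋆ ∷ S))          ≡⟨ cong f (starred-++-∷ (emb u) ⋆ S) ⟩
  𝟘 ∷ replaceFirst 𝟙 (emb u ++ ⋆ ∷ S ++ [ ⋆ ]) ≡⟨ cong (𝟘 ∷_) (replaceFirst-emb-++ 𝟙 u _) ⟩
  𝟘 ∷ emb u ++ 𝟙 ∷ S ++ [ ⋆ ]           ∎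
  where open ≡-Reasoning

hamming-++ˡ : ∀ xs ys zs → hamming (xs ++ ys) (xs ++ zs) ≡ hamming ys zs
hamming-++ˡ []       ys zs = refl
hamming-++ˡ (𝟘 ∷ xs) ys zs = hamming-++ˡ xs ys zs
hamming-++ˡ (𝟙 ∷ xs) ys zs = hamming-++ˡ xs ys zs
hamming-++ˡ (⋆ ∷ xs) ys zs = hamming-++ˡ xs ys zs

bitDiff-refl : ∀ u → bitDiff u u ≡ 0
bitDiff-refl []          = refl
bitDiff-refl (false ∷ u) = bitDiff-refl u
bitDiff-refl (true ∷ u)  = bitDiff-refl u

bitDiff-++ˡ : ∀ u xs ys → bitDiff (u ++ xs) (u ++ ys) ≡ bitDiff xs ys
bitDiff-++ˡ []          xs ys = refl
bitDiff-++ˡ (false ∷ u) xs ys = bitDiff-++ˡ u xs ys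
bitDiff-++ˡ (true ∷ u)  xs ys = bitDiff-++ˡ u xs ys

bitDiff-flip : ∀ u v → bitDiff (u ++ false ∷ v) (u ++ true ∷ v) ≡ 1
bitDiff-flip u v = trans (bitDiff-++ˡ u (false ∷ v) (true ∷ v)) (cong suc (bitDiff-refl v))

map-emb-++ : ∀ {g : Sym → Bool} → g ∘ bitSym ≗ id → ∀ u S → map g (emb u ++ S) ≡ u ++ map g S
map-emb-++ g∘bitSym≗id []      S = refl
map-emb-++ g∘bitSym≗id (b ∷ u) S = cong₂ _∷_ (g∘bitSym≗id b) (map-emb-++ g∘bitSym≗id u S)

map-emb-∷-emb : ∀ {g : Sym → Bool} → g ∘ bitSym ≗ id →
  ∀ u a v S → map g (emb u ++ a ∷ emb v ++ S) ≡ u ++ g a ∷ v ++ map g S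
map-emb-∷-emb {g} g∘bitSym≗id u a v S =
  trans (map-emb-++ g∘bitSym≗id u _) (cong (λ zs → u ++ g a ∷ zs) (map-emb-++ g∘bitSym≗id v S))

bottomSym∘bitSym≗id : bottomSym ∘ bitSym ≗ id
bottomSym∘bitSym≗id false = refl
bottomSym∘bitSym≗id true  = refl

topSym∘bitSym≗id : topSym ∘ bitSym ≗ id
topSym∘bitSym≗id false = refl
topSym∘bitSym≗id true  = refl

module _ {C : List Sym} (u v : Bits) (C≡ : C ≡ emb u ++ ⋆ ∷ emb v) where
  open ≡-Reasoning

  ℓ-starred-one-star : ℓ (starred C) ≡ ⋆ ∷ emb u ++ 𝟘 ∷ emb v ++ [ 𝟙 ]
  ℓ-starred-one-star = begin
    reverse (ℓaux (reverse (starred C)))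
      ≡⟨ cong (reverse ∘ ℓaux ∘ reverse) (trans (cong starred C≡) (starred-++-∷ (emb u) ⋆ (emb v))) ⟩
    reverse (ℓaux (reverse (⋆ ∷ emb u ++ ⋆ ∷ emb v ++ [ ⋆ ])))
      ≡⟨ cong (reverse ∘ ℓaux) (reverse-frame ⋆ ⋆ ⋆ (emb u) (emb v)) ⟩
    reverse (ℓaux (⋆ ∷ reverse (emb v) ++ ⋆ ∷ reverse (emb u) ++ [ ⋆ ]))
      ≡⟨ cong (λ zs → reverse (ℓaux (⋆ ∷ zs ++ ⋆ ∷ reverse (emb u) ++ [ ⋆ ]))) (reverse-emb v) ⟩
    reverse (𝟙 ∷ replaceFirst 𝟘 (emb (reverse v) ++ ⋆ ∷ reverse (emb u) ++ [ ⋆ ]))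
      ≡⟨ cong (reverse ∘ (𝟙 ∷_)) (replaceFirst-emb-++ 𝟘 (reverse v) _) ⟩
    reverse (𝟙 ∷ emb (reverse v) ++ 𝟘 ∷ reverse (emb u) ++ [ ⋆ ])
      ≡⟨ reverse-frame 𝟙 𝟘 ⋆ (emb (reverse v)) (reverse (emb u)) ⟩
    ⋆ ∷ reverse (reverse (emb u)) ++ 𝟘 ∷ reverse (emb (reverse v)) ++ [ 𝟙 ]
      ≡⟨ cong₂ (λ xs ys → ⋆ ∷ xs ++ 𝟘 ∷ ys ++ [ 𝟙 ])
           (reverse-involutive (emb u))
           (trans (reverse-emb (reverse v)) (cong emb (reverse-involutive v))) ⟩
    ⋆ ∷ emb u ++ 𝟘 ∷ emb v ++ [ 𝟙 ] ∎

  f-starred-one-star : f (starred C) ≡ 𝟘 ∷ emb u ++ 𝟙 ∷ emb v ++ [ ⋆ ]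
  f-starred-one-star = trans (cong (f ∘ starred) C≡) (f-starred-emb-++ u (emb v))

  starred-ℓ-starred-one-star : starred (ℓ (starred C)) ≡ ⋆ ∷ ⋆ ∷ emb u ++ 𝟘 ∷ emb v ++ 𝟙 ∷ [ ⋆ ]
  starred-ℓ-starred-one-star = trans (cong starred ℓ-starred-one-star) (starred-frame ⋆ (emb u) 𝟘 (emb v) 𝟙)

  f-starred-f-starred-one-star : f (starred (f (starred C))) ≡ 𝟘 ∷ 𝟘 ∷ emb u ++ 𝟙 ∷ emb v ++ 𝟙 ∷ [ ⋆ ]
  f-starred-f-starred-one-star = begin
    f (starred (f (starred C)))
      ≡⟨ cong f (trans (cong starred f-starred-one-star) (starred-frame 𝟘 (emb u) 𝟙 (emb v) ⋆)) ⟩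
    𝟘 ∷ 𝟘 ∷ replaceFirst 𝟙 (emb u ++ 𝟙 ∷ emb v ++ ⋆ ∷ [ ⋆ ])
      ≡⟨ cong (λ zs → 𝟘 ∷ 𝟘 ∷ zs) (replaceFirst-emb-++ 𝟙 u _) ⟩
    𝟘 ∷ 𝟘 ∷ emb u ++ 𝟙 ∷ replaceFirst 𝟙 (emb v ++ ⋆ ∷ [ ⋆ ])
      ≡⟨ cong (λ zs → 𝟘 ∷ 𝟘 ∷ emb u ++ 𝟙 ∷ zs) (replaceFirst-emb-++ 𝟙 v _) ⟩
    𝟘 ∷ 𝟘 ∷ emb u ++ 𝟙 ∷ emb v ++ 𝟙 ∷ [ ⋆ ] ∎

  hamming-ℓ-f-starred-one-star : hamming (ℓ (starred C)) (f (starred C)) ≡ 3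
  hamming-ℓ-f-starred-one-star = begin
    hamming (ℓ (starred C)) (f (starred C))
      ≡⟨ cong₂ hamming ℓ-starred-one-star f-starred-one-star ⟩
    suc (hamming (emb u ++ 𝟘 ∷ emb v ++ [ 𝟙 ]) (emb u ++ 𝟙 ∷ emb v ++ [ ⋆ ]))
      ≡⟨ cong suc (hamming-++ˡ (emb u) _ _) ⟩
    suc (suc (hamming (emb v ++ [ 𝟙 ]) (emb v ++ [ ⋆ ])))
      ≡⟨ cong (suc ∘ suc) (hamming-++ˡ (emb v) _ _) ⟩
    3 ∎

  hamming-starred-ℓ-f-starred-f-one-star :
    hamming (starred (ℓ (starred C))) (f (starred (f (starred C)))) ≡ 3
  hamming-starred-ℓ-f-starred-f-one-star = begin
    hamming (starred (ℓ (starred C))) (f (starred (f (starred C))))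
      ≡⟨ cong₂ hamming starred-ℓ-starred-one-star f-starred-f-starred-one-star ⟩
    suc (suc (hamming (emb u ++ 𝟘 ∷ emb v ++ 𝟙 ∷ [ ⋆ ]) (emb u ++ 𝟙 ∷ emb v ++ 𝟙 ∷ [ ⋆ ])))
      ≡⟨ cong (suc ∘ suc) (hamming-++ˡ (emb u) _ _) ⟩
    suc (suc (suc (hamming (emb v ++ 𝟙 ∷ [ ⋆ ]) (emb v ++ 𝟙 ∷ [ ⋆ ]))))
      ≡⟨ cong (suc ∘ suc ∘ suc) (hamming-++ˡ (emb v) _ _) ⟩
    3 ∎

  bitDiff-bottom-ℓ-top-f-starred-one-star : bitDiff (bottom (ℓ (starred C))) (top (f (starred C))) ≡ 1
  bitDiff-bottom-ℓ-top-f-starred-one-star = begin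
    bitDiff (bottom (ℓ (starred C))) (top (f (starred C)))
      ≡⟨ cong₂ (λ L F → bitDiff (bottom L) (top F)) ℓ-starred-one-star f-starred-one-star ⟩
    bitDiff (bottom (emb u ++ 𝟘 ∷ emb v ++ [ 𝟙 ])) (top (emb u ++ 𝟙 ∷ emb v ++ [ ⋆ ]))
      ≡⟨ cong₂ bitDiff (map-emb-∷-emb bottomSym∘bitSym≗id u 𝟘 v _) (map-emb-∷-emb topSym∘bitSym≗id u 𝟙 v _) ⟩
    bitDiff (u ++ false ∷ v ++ [ true ]) (u ++ true ∷ v ++ [ true ])
      ≡⟨ bitDiff-flip u (v ++ [ true ]) ⟩
    1 ∎

  bitDiff-bottom-starred-ℓ-f-starred-f-one-star :
    bitDiff (bottom (starred (ℓ (starred C)))) (bottom (f (starred (f (starred C))))) ≡ 1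
  bitDiff-bottom-starred-ℓ-f-starred-f-one-star = begin
    bitDiff (bottom (starred (ℓ (starred C)))) (bottom (f (starred (f (starred C)))))
      ≡⟨ cong₂ (λ L F → bitDiff (bottom L) (bottom F)) starred-ℓ-starred-one-star f-starred-f-starred-one-star ⟩
    bitDiff (bottom (emb u ++ 𝟘 ∷ emb v ++ 𝟙 ∷ [ ⋆ ])) (bottom (emb u ++ 𝟙 ∷ emb v ++ 𝟙 ∷ [ ⋆ ]))
      ≡⟨ cong₂ bitDiff (map-emb-∷-emb bottomSym∘bitSym≗id u 𝟘 v _) (map-emb-∷-emb bottomSym∘bitSym≗id u 𝟙 v _) ⟩
    bitDiff (u ++ false ∷ v ++ true ∷ [ false ]) (u ++ true ∷ v ++ true ∷ [ false ])
      ≡⟨ bitDiff-flip u (v ++ true ∷ [ false ]) ⟩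
    1 ∎

length-starred-+2 : ∀ {n} S → length S ≡ n → length (starred S) ≡ n + 2
length-starred-+2 {n} S ∣S∣≡n = trans (length-starred S) (trans (cong (suc ∘ suc) ∣S∣≡n) (+-comm 2 n))

lemma22 : (n : ℕ) → n % 2 ≡ 1 → 3 ≤ n →
    (C : List Sym) → GKChainOf (n ∸ 2) C → stars C ≡ 1 →
    Adjacent n (bottom (ℓ (starred C))) (top (f (starred C)))
    × Adjacent (n + 2) (bottom (starred (ℓ (starred C)))) (bottom (f (starred (f (starred C)))))
    × ((u v : Bits) → D u → D v → C ≡ emb u ++ ⋆ ∷ emb v →
        (ℓ (starred C) ≡ ⋆ ∷ emb u ++ 𝟘 ∷ emb v ++ [ 𝟙 ])
        × (f (starred C) ≡ 𝟘 ∷ emb u ++ 𝟙 ∷ emb v ++ [ ⋆ ])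
        × (starred (ℓ (starred C)) ≡ ⋆ ∷ ⋆ ∷ emb u ++ 𝟘 ∷ emb v ++ 𝟙 ∷ [ ⋆ ])
        × (f (starred (f (starred C))) ≡ 𝟘 ∷ 𝟘 ∷ emb u ++ 𝟙 ∷ emb v ++ 𝟙 ∷ [ ⋆ ])
        × (hamming (ℓ (starred C)) (f (starred C)) ≡ 3)
        × (hamming (starred (ℓ (starred C))) (f (starred (f (starred C)))) ≡ 3))
lemma22 n _ 3≤n C (gk , ∣C∣≡n∸2) one with one-star-chain gk one
... | u , v , C≡ =
    ( trans (length-map bottomSym (ℓ (starred C))) ∣ℓ⋆C⋆∣≡n
    , trans (length-map topSym (f (starred C))) ∣f⋆C⋆∣≡n
    , bitDiff-bottom-ℓ-top-f-starred-one-star u v C≡ )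
  , ( trans (length-map bottomSym (starred (ℓ (starred C)))) (length-starred-+2 (ℓ (starred C)) ∣ℓ⋆C⋆∣≡n)
    , trans (length-map bottomSym (f (starred (f (starred C)))))
        (trans (length-f (starred (f (starred C)))) (length-starred-+2 (f (starred C)) ∣f⋆C⋆∣≡n))
    , bitDiff-bottom-starred-ℓ-f-starred-f-one-star u v C≡ )
  , λ u′ v′ _ _ C≡′ →
      ℓ-starred-one-star u′ v′ C≡′ , f-starred-one-star u′ v′ C≡′
    , starred-ℓ-starred-one-star u′ v′ C≡′ , f-starred-f-starred-one-star u′ v′ C≡′
    , hamming-ℓ-f-starred-one-star u′ v′ C≡′ , hamming-starred-ℓ-f-starred-f-one-star u′ v′ C≡′
  where
  ∣⋆C⋆∣≡n : length (starred C) ≡ n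
  ∣⋆C⋆∣≡n = trans (length-starred C) (trans (cong (suc ∘ suc) ∣C∣≡n∸2) (m+[n∸m]≡n (≤-trans (n≤1+n 2) 3≤n)))

  ∣ℓ⋆C⋆∣≡n : length (ℓ (starred C)) ≡ n
  ∣ℓ⋆C⋆∣≡n = trans (length-ℓ (starred C)) ∣⋆C⋆∣≡n

  ∣f⋆C⋆∣≡n : length (f (starred C)) ≡ n
  ∣f⋆C⋆∣≡n = trans (length-f (starred C)) ∣⋆C⋆∣≡n
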